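{- $\sup\{c(G) : G \text{ a finite connected graph with no induced subgraph isomorphic to } 4K_1\}=3$.
   Context: $4K_1$ denotes the edgeless graph on $4$ vertices. The game of cops and robber on a connected graph $G$: first the cops are placed on vertices, then the robber chooses a vertex; then the players alternate, in each cops' turn every cop moves to an adjacent vertex or stays, and in each robber's turn the robber moves to an adjacent vertex or stays, with full information. The cops win if a cop eventually occupies the robber's vertex. The cop number $c(G)$ is the minimum number of cops guaranteeing a win for the cops. -}

module Defs where

open import Data.Nat using (ℕ; zero; suc; _<_; _≤_)
open import Data.Fin using (Fin)
open import Data.Bool using (Bool; true; false)
open import Data.Product using (Σ; ∃; _×_; _,_)
open import Data.Sum using (_⊎_)
open import Relation.Binary.PropositionalEquality using (_≡_; _≢_)
open import Relation.Binary.Construct.Closure.ReflexiveTransitive using (Star)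
open import Relation.Nullary using (¬_)
open import Function.Definitions using (Injective)

record Graph : Set where
  field
    n     : ℕ
    adj   : Fin n → Fin n → Bool
    sym   : ∀ u v → adj u v ≡ adj v u
    irrefl : ∀ v → adj v v ≡ false

open Graph public

V : Graph → Set
V G = Fin (n G)

Edge : (G : Graph) → V G → V G → Set
Edge G u v = adj G u v ≡ true

Connected : Graph → Set
Connected G = (0 < n G) × (∀ u v → Star (Edge G) u v)

InducedCopy : Graph → Graph → Set
InducedCopy H G =
  Σ (V H → V G) λ f → Injective _≡_ _≡_ f × (∀ u v → adj G (f u) (f v) ≡ adj H u v)

edgeless : ℕ → Graph
edgeless m = record { n = m ; adj = λ _ _ → false ; sym = λ _ _ → _≡_.refl ; irrefl = λ _ → _≡_.refl }

FourK1Free : Graph → Set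
FourK1Free G = ¬ InducedCopy (edgeless 4) G

Move : (G : Graph) → V G → V G → Set
Move G u v = (u ≡ v) ⊎ Edge G u v

-- CopsWinFrom G c r : with k cops at positions c, robber at r, and the cops
-- to move, the cops can force a capture (in finitely many rounds; on a
-- finite graph this is equivalent to "eventually" capturing).
data CopsWinFrom (G : Graph) {k : ℕ} : (Fin k → V G) → V G → Set where
  caught : ∀ {c r} (i : Fin k) → c i ≡ r → CopsWinFrom G c r
  step   : ∀ {c r} (c' : Fin k → V G) →
           (∀ i → Move G (c i) (c' i)) →
           ((∃ λ i → c' i ≡ r) ⊎ (∀ r' → Move G r r' → CopsWinFrom G c' r')) →
           CopsWinFrom G c r

CopsWin : ℕ → Graph → Set
CopsWin k G = Σ (Fin k → V G) λ c → ∀ r → CopsWinFrom G c r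

CopNumber : Graph → ℕ → Set
CopNumber G k = CopsWin k G × (∀ j → j < k → ¬ CopsWin j G)

-- Upper bound: a maximal independent set is dominating, so in a 4K₁-free
-- graph some at most three vertices dominate, and three cops placed there
-- catch the robber in their first move. Whether k cops win is decidable:
-- the cops' winning positions are the least fixed point of the one-round
-- attractor on the finite set of positions, reached by iteration from ∅.
-- Hence the least winning number of cops exists, and it is at most 3.
-- Lower bound: the Paley graph P₁₇ has no independent set of size 4, yet
-- against any two cops the robber can always step outside both cops'
-- closed neighbourhoods, so he is never caught.
module Submission where

open import Defs hiding (sym)
open import Data.Nat using (ℕ; zero; suc; _+_; _∸_; _%_; _^_; _*_; _≤_; _<_; z≤n; s≤s; s≤s⁻¹)
open import Data.Nat.Properties using (≤-refl; ≤-trans; ≤-<-trans; m≤n⇒m≤1+n; m≤n⇒m<n∨m≡n; 1+n≰n)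
open import Data.Bool using (Bool; true; false; T; not; _∧_; _∨_)
import Data.Bool.Properties as Bool
open import Data.Empty using (⊥-elim)
open import Data.Fin using (Fin; zero; suc; toℕ; fromℕ<; _≟_; combine; remQuot)
open import Data.Fin.Base using (finToFun; funToFin)
open import Data.Fin.Patterns using (0F; 1F; 2F; 3F)
open import Data.Fin.Properties using (all?; any?; ¬∀⟶∃¬; remQuot-combine; finToFun-funToFin)
open import Data.Fin.Subset using (Subset; _∈_; _⊆_; _⊂_; _∪_; ∣_∣) renaming (⊥ to ∅)
open import Data.Fin.Subset.Properties using (_∈?_; _⊂?_; ∉⊥; p⊆p∪q; q⊆p∪q; x∈p∪q⁻; p⊂q⇒∣p∣<∣q∣; ∣p∣≤n)
open import Data.Product using (Σ; ∃; _×_; _,_; uncurry; map₂)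
open import Data.Sum using (_⊎_; inj₁; inj₂; [_,_])
open import Data.List using (allFin)
open import Data.Bool.ListAction using (all; any)
import Data.List.Relation.Unary.All as All
import Data.List.Relation.Unary.Any as Any
open import Data.List.Relation.Unary.All.Properties using (all⁺)
open import Data.List.Relation.Unary.Any.Properties using (any⁻)
open import Data.List.Membership.Propositional.Properties using (∈-allFin)
open import Data.Vec using (tabulate)
open import Data.Vec.Properties using (lookup∘tabulate; []=⇒lookup; lookup⇒[]=)
open import Data.Vec.Functional using ([]; _∷_; updateAt)
open import Data.Vec.Functional.Properties using (updateAt-updates; updateAt-minimal)
open import Function using (_∘_; Equivalence)
open import Relation.Binary.PropositionalEquality
  using (_≡_; _≢_; refl; sym; trans; cong; subst; subst₂)
open import Relation.Binary.Construct.Closure.ReflexiveTransitive using (Star; ε; _◅_; _◅◅_)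
open import Relation.Nullary using (¬_; Dec; yes; no; does; contradiction)
open import Relation.Nullary.Decidable using (map′; ⌊_⌋; toWitness; toWitnessFalse; dec-true; _×-dec_; _⊎-dec_; _→-dec_)
open import Relation.Unary using (Pred; Decidable)
open import Level using (0ℓ)

least-upTo : ∀ {P : ℕ → Set} → Decidable P → ∀ k →
             (∃ λ j → j ≤ k × P j × (∀ i → i < j → ¬ P i)) ⊎ (∀ i → i ≤ k → ¬ P i)
least-upTo P? zero with P? zero
... | yes p = inj₁ (0 , z≤n , p , λ _ ())
... | no ¬p = inj₂ λ { zero _ → ¬p }
least-upTo {P} P? (suc k) with least-upTo P? k
... | inj₁ (j , j≤k , pj , minimal) = inj₁ (j , m≤n⇒m≤1+n j≤k , pj , minimal)
... | inj₂ none with P? (suc k)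
...   | yes p = inj₁ (suc k , ≤-refl , p , λ i i<1+k → none i (s≤s⁻¹ i<1+k))
...   | no ¬p = inj₂ λ i i≤1+k → below-or-at (m≤n⇒m<n∨m≡n i≤1+k)
  where
  below-or-at : ∀ {i} → i < suc k ⊎ i ≡ suc k → ¬ P i
  below-or-at (inj₁ i<1+k) = none _ (s≤s⁻¹ i<1+k)
  below-or-at (inj₂ refl) = ¬p

least : ∀ {P : ℕ → Set} → Decidable P → ∀ {k} → P k →
        ∃ λ j → j ≤ k × P j × (∀ i → i < j → ¬ P i)
least P? {k} pk with least-upTo P? k
... | inj₁ found = found
... | inj₂ none = contradiction pk (none k ≤-refl)

module Iteration {m} (F : Subset m → Subset m) where

  approx : ℕ → Subset m
  approx zero = ∅
  approx (suc t) = approx t ∪ F (approx t)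

  private
    grows-or-closed : ∀ t → t ≤ ∣ approx t ∣ ⊎ ∃ λ s → F (approx s) ⊆ approx s
    grows-or-closed zero = inj₁ z≤n
    grows-or-closed (suc t) with grows-or-closed t | approx t ⊂? approx (suc t)
    ... | inj₂ closed | _ = inj₂ closed
    ... | inj₁ t≤∣W∣ | yes W⊂W′ = inj₁ (≤-<-trans t≤∣W∣ (p⊂q⇒∣p∣<∣q∣ W⊂W′))
    ... | inj₁ _ | no W⊄W′ = inj₂ (t , closed)
      where
      closed : F (approx t) ⊆ approx t
      closed {x} x∈FW with x ∈? approx t
      ... | yes x∈W = x∈W
      ... | no x∉W = contradiction W⊂W′ W⊄W′
        where
        W⊂W′ : approx t ⊂ approx (suc t)
        W⊂W′ = p⊆p∪q (F (approx t)) , x , q⊆p∪q (approx t) _ x∈FW , x∉W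

  approx-closed : ∃ λ t → F (approx t) ⊆ approx t
  approx-closed with grows-or-closed (suc m)
  ... | inj₁ m<∣W∣ = contradiction (≤-trans m<∣W∣ (∣p∣≤n (approx (suc m)))) 1+n≰n
  ... | inj₂ closed = closed

module _ {m} {P : Pred (Fin m) 0ℓ} (P? : Decidable P) where

  satisfying : Subset m
  satisfying = tabulate (does ∘ P?)

  ∈-satisfying⁺ : ∀ {x} → P x → x ∈ satisfying
  ∈-satisfying⁺ {x} px = lookup⇒[]= x _ (trans (lookup∘tabulate _ x) (dec-true (P? x) px))

  ∈-satisfying⁻ : ∀ {x} → x ∈ satisfying → P x
  ∈-satisfying⁻ {x} x∈ with P? x | trans (sym (lookup∘tabulate _ x)) ([]=⇒lookup x∈)
  ... | yes px | _ = px
  ... | no _ | ()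

-- Boolean searches over Fin, for facts checked by evaluation: evaluating the
-- Dec-valued all?/any? instead exhausts the type checker's memory. They are
-- opaque so that the predicate searched is inferred rather than evaluated.
opaque
  allᶠ : ∀ {m} → (Fin m → Bool) → Bool
  allᶠ p = all p (allFin _)

  anyᶠ : ∀ {m} → (Fin m → Bool) → Bool
  anyᶠ p = any p (allFin _)

  allᶠ-sound : ∀ {m} {p : Fin m → Bool} → T (allᶠ p) → ∀ i → T (p i)
  allᶠ-sound {p = p} ok i = All.lookup (all⁺ p (allFin _) ok) (∈-allFin i)

  anyᶠ-sound : ∀ {m} {p : Fin m → Bool} → T (anyᶠ p) → ∃ λ i → T (p i)
  anyᶠ-sound {p = p} ok = Any.satisfied (any⁻ p (allFin _) ok)

module _ (G : Graph) where

  Move? : ∀ u v → Dec (Move G u v)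
  Move? u v = (u ≟ v) ⊎-dec (adj G u v Bool.≟ true)

  Move-sym : ∀ {u v} → Move G u v → Move G v u
  Move-sym (inj₁ u≡v) = inj₁ (sym u≡v)
  Move-sym {u} {v} (inj₂ uv) = inj₂ (trans (Graph.sym G v u) uv)

  Moves : ∀ {k} → (Fin k → V G) → (Fin k → V G) → Set
  Moves c c′ = ∀ i → Move G (c i) (c′ i)

  Caught : ∀ {k} → (Fin k → V G) → V G → Set
  Caught c r = ∃ λ i → c i ≡ r

  Safe : ∀ {k} → (Fin k → V G) → V G → Set
  Safe c r = ∀ i → ¬ Move G (c i) r

  Dominating : ∀ {k} → (Fin k → V G) → Set
  Dominating c = ∀ r → ∃ λ i → Move G (c i) r

  Independent : ∀ {m} → (Fin m → V G) → Set
  Independent f = ∀ u v → u ≢ v → ¬ Move G (f u) (f v)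

  dominating⇒CopsWin : ∀ {k} (c : Fin k → V G) → Dominating c → CopsWin k G
  dominating⇒CopsWin c dominating = c , λ r → chase r (dominating r)
    where
    chase : ∀ r → ∃ (λ i → Move G (c i) r) → CopsWinFrom G c r
    chase r (i , inj₁ ci≡r) = caught i ci≡r
    chase r (i , inj₂ ci~r) = step c′ moves (inj₁ (i , updateAt-updates i c))
      where
      c′ = updateAt c i (λ _ → r)
      moves : Moves c c′
      moves j with j ≟ i
      ... | yes refl = subst (Move G (c i)) (sym (updateAt-updates i c)) (inj₂ ci~r)
      ... | no j≢i = subst (Move G (c j)) (sym (updateAt-minimal j i c j≢i)) (inj₁ refl)

  reached? : ∀ {k} (c : Fin k → V G) r → Dec (∃ λ i → Move G (c i) r)
  reached? c r = any? λ i → Move? (c i) r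

  dominating-or-avoided : ∀ {k} (c : Fin k → V G) → Dominating c ⊎ ∃ (Safe c)
  dominating-or-avoided c with all? (reached? c)
  ... | yes dominating = inj₁ dominating
  ... | no ¬dominating =
    inj₂ (map₂ (λ unreached i m → unreached (i , m)) (¬∀⟶∃¬ _ _ (reached? c) ¬dominating))

  independent-[] : Independent []
  independent-[] ()

  independent-∷ : ∀ {m r} {f : Fin m → V G} → Independent f → Safe f r → Independent (r ∷ f)
  independent-∷ indep r-safe zero zero 0≢0 = contradiction refl 0≢0
  independent-∷ indep r-safe zero (suc v) _ = r-safe v ∘ Move-sym
  independent-∷ indep r-safe (suc u) zero _ = r-safe u
  independent-∷ indep r-safe (suc u) (suc v) u≢v = indep u v (u≢v ∘ cong suc)

  independent⇒edgeless-copy : ∀ {m} (f : Fin m → V G) → Independent f → InducedCopy (edgeless m) G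
  independent⇒edgeless-copy f indep = f , injective , non-adjacent
    where
    injective : ∀ {u v} → f u ≡ f v → u ≡ v
    injective {u} {v} fu≡fv with u ≟ v
    ... | yes u≡v = u≡v
    ... | no u≢v = contradiction (inj₁ fu≡fv) (indep u v u≢v)
    non-adjacent : ∀ u v → adj G (f u) (f v) ≡ false
    non-adjacent u v with u ≟ v
    ... | yes refl = irrefl G (f u)
    ... | no u≢v = Bool.¬-not (indep u v u≢v ∘ inj₂)

  edgeless-copy⇒independent : ∀ {m} ((f , _) : InducedCopy (edgeless m) G) → Independent f
  edgeless-copy⇒independent (f , injective , adjacency) u v u≢v (inj₁ fu≡fv) = u≢v (injective fu≡fv)
  edgeless-copy⇒independent (f , injective , adjacency) u v u≢v (inj₂ fu~fv) =
    contradiction (trans (sym fu~fv) (adjacency u v)) λ ()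

  copsWinFrom-∘ : ∀ {j k} (σ : Fin k → Fin j) → (∀ i → ∃ λ i′ → σ i′ ≡ i) →
                  ∀ {c r} → CopsWinFrom G c r → CopsWinFrom G (c ∘ σ) r
  copsWinFrom-∘ σ onto (caught i ci≡r) with onto i
  ... | i′ , refl = caught i′ ci≡r
  copsWinFrom-∘ σ onto (step c′ moves (inj₁ (i , c′i≡r))) with onto i
  ... | i′ , refl = step (c′ ∘ σ) (moves ∘ σ) (inj₁ (i′ , c′i≡r))
  copsWinFrom-∘ σ onto (step c′ moves (inj₂ next)) =
    step (c′ ∘ σ) (moves ∘ σ) (inj₂ λ r′ m → copsWinFrom-∘ σ onto (next r′ m))

  copsWin-∘ : ∀ {j k} (σ : Fin k → Fin j) → (∀ i → ∃ λ i′ → σ i′ ≡ i) → CopsWin j G → CopsWin k G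
  copsWin-∘ σ onto (c , win) = c ∘ σ , λ r → copsWinFrom-∘ σ onto (win r)

  robber-evades : ∀ {k} → (∀ (c : Fin k → V G) → ∃ (Safe c)) →
                  (∀ (c : Fin k → V G) r → (∀ i → c i ≢ r) → ∃ λ r′ → Move G r r′ × Safe c r′) →
                  ¬ CopsWin k G
  robber-evades start escape (c , win) with start c
  ... | r , safe = evade safe (win r)
    where
    missed : ∀ {c c′ r} → Safe c r → Moves c c′ → ∀ i → c′ i ≢ r
    missed {c} safe moves i c′i≡r = safe i (subst (Move G (c i)) c′i≡r (moves i))
    evade : ∀ {c r} → Safe c r → ¬ CopsWinFrom G c r
    evade safe (caught i ci≡r) = safe i (inj₁ ci≡r)
    evade safe (step c′ moves (inj₁ (i , c′i≡r))) = missed safe moves i c′i≡r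
    evade {r = r} safe (step c′ moves (inj₂ next)) with escape c′ r (missed safe moves)
    ... | r′ , m , safe′ = evade safe′ (next r′ m)

  no-cops-lose : 0 < n G → ¬ CopsWin 0 G
  no-cops-lose n>0 = robber-evades (λ _ → fromℕ< n>0 , λ ()) (λ _ r _ → r , inj₁ refl , λ ())

  move⇒walk : ∀ {u v} → Move G u v → Star (Edge G) u v
  move⇒walk (inj₁ refl) = ε
  move⇒walk (inj₂ uv) = uv ◅ ε

-- A position (cops c, robber r) is encoded as combine (funToFin c) r : Fin (n G ^ k * n G).
module Decision (G : Graph) (k : ℕ) where

  Code : Set
  Code = Fin (n G ^ k)

  placement : Code → Fin k → V G
  placement = finToFun

  Region : Set
  Region = Subset (n G ^ k * n G)

  Round : Region → Code → V G → Set
  Round X p r = Caught G (placement p) r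
              ⊎ ∃ λ q → Moves G (placement p) (placement q)
                        × (Caught G (placement q) r ⊎ (∀ r′ → Move G r r′ → combine q r′ ∈ X))

  round? : ∀ X p r → Dec (Round X p r)
  round? X p r =
    caught? p
    ⊎-dec any? λ q → (all? λ i → Move? G (placement p i) (placement q i))
                     ×-dec (caught? q ⊎-dec all? λ r′ → Move? G r r′ →-dec combine q r′ ∈? X)
    where
    caught? : ∀ p → Dec (Caught G (placement p) r)
    caught? p = any? λ i → placement p i ≟ r

  round-at? : ∀ X s → Dec (uncurry (Round X) (remQuot (n G) s))
  round-at? X s = uncurry (round? X) (remQuot (n G) s)

  attract : Region → Region
  attract X = satisfying (round-at? X)

  attract⁻ : ∀ {X p r} → combine p r ∈ attract X → Round X p r
  attract⁻ {X} {p} {r} x∈ = subst (uncurry (Round X)) (remQuot-combine p r) (∈-satisfying⁻ (round-at? X) x∈)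

  attract⁺ : ∀ {X p r} → Round X p r → combine p r ∈ attract X
  attract⁺ {X} {p} {r} round = ∈-satisfying⁺ (round-at? X) (subst (uncurry (Round X)) (sym (remQuot-combine p r)) round)

  Winning : Region → Set
  Winning X = ∀ {p r} → combine p r ∈ X → CopsWinFrom G (placement p) r

  round-winning : ∀ {X p r} → Winning X → Round X p r → CopsWinFrom G (placement p) r
  round-winning _ (inj₁ (i , ci≡r)) = caught i ci≡r
  round-winning _ (inj₂ (q , moves , inj₁ caught′)) = step (placement q) moves (inj₁ caught′)
  round-winning winning (inj₂ (q , moves , inj₂ next)) =
    step (placement q) moves (inj₂ λ r′ m → winning (next r′ m))

  open Iteration attract

  approx-winning : ∀ t → Winning (approx t)
  approx-winning zero x∈∅ = contradiction x∈∅ ∉⊥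
  approx-winning (suc t) x∈ with x∈p∪q⁻ (approx t) _ x∈
  ... | inj₁ x∈W = approx-winning t x∈W
  ... | inj₂ x∈FW = round-winning (approx-winning t) (attract⁻ x∈FW)

  winning∈closed : ∀ {X} → attract X ⊆ X → ∀ {c r} → CopsWinFrom G c r → combine (funToFin c) r ∈ X
  winning∈closed closed {c} (caught i ci≡r) =
    closed (attract⁺ (inj₁ (i , trans (finToFun-funToFin c i) ci≡r)))
  winning∈closed {X} closed {c} {r} (step c′ moves next) =
    closed (attract⁺ (inj₂ (funToFin c′ , moves′ , continue next)))
    where
    moves′ : Moves G (placement (funToFin c)) (placement (funToFin c′))
    moves′ i = subst₂ (Move G) (sym (finToFun-funToFin c i)) (sym (finToFun-funToFin c′ i)) (moves i)
    continue : Caught G c′ r ⊎ (∀ r′ → Move G r r′ → CopsWinFrom G c′ r′) →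
               Caught G (placement (funToFin c′)) r ⊎ (∀ r′ → Move G r r′ → combine (funToFin c′) r′ ∈ X)
    continue (inj₁ (i , c′i≡r)) = inj₁ (i , trans (finToFun-funToFin c′ i) c′i≡r)
    continue (inj₂ next′) = inj₂ λ r′ m → winning∈closed closed (next′ r′ m)

  copsWin? : Dec (CopsWin k G)
  copsWin? with approx-closed
  ... | t , closed = map′ sound complete (any? λ p → all? λ r → combine p r ∈? approx t)
    where
    sound : (∃ λ p → ∀ r → combine p r ∈ approx t) → CopsWin k G
    sound (p , winning) = placement p , λ r → approx-winning t (winning r)
    complete : CopsWin k G → ∃ λ p → ∀ r → combine p r ∈ approx t
    complete (c , win) = funToFin c , λ r → winning∈closed closed (win r)

open Decision using (copsWin?)

-- Cops may share vertices, so the greedy choices a, b, c are padded by repetition.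
three-cops-win : ∀ G → 0 < n G → FourK1Free G → CopsWin 3 G
three-cops-win G n>0 free with fromℕ< n>0
... | a with dominating-or-avoided G (a ∷ a ∷ a ∷ [])
... | inj₁ dominating = dominating⇒CopsWin G _ dominating
... | inj₂ (b , b-safe) with dominating-or-avoided G (b ∷ a ∷ a ∷ [])
... | inj₁ dominating = dominating⇒CopsWin G _ dominating
... | inj₂ (c , c-safe) with dominating-or-avoided G (c ∷ b ∷ a ∷ [])
... | inj₁ dominating = dominating⇒CopsWin G _ dominating
... | inj₂ (d , d-safe) = ⊥-elim (free (independent⇒edgeless-copy G (d ∷ c ∷ b ∷ a ∷ []) independent))
  where
  independent : Independent G (d ∷ c ∷ b ∷ a ∷ [])
  independent =
    independent-∷ G (independent-∷ G (independent-∷ G (independent-∷ G (independent-[] G)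
      λ ()) λ { zero → b-safe zero }) λ { zero → c-safe zero ; (suc zero) → c-safe (suc zero) }) d-safe

at-most-three-cops : ∀ G → Connected G → FourK1Free G → ∃ λ k → CopNumber G k × k ≤ 3
at-most-three-cops G (n>0 , _) free with least (λ j → copsWin? G j) (three-cops-win G n>0 free)
... | j , j≤3 , win , fewer-lose = j , (win , fewer-lose) , j≤3

-- The Paley graph P₁₇: i ~ j iff i - j is a nonzero square mod 17.
nonzero-square-mod17 : ℕ → Bool
nonzero-square-mod17 1 = true
nonzero-square-mod17 2 = true
nonzero-square-mod17 4 = true
nonzero-square-mod17 8 = true
nonzero-square-mod17 9 = true
nonzero-square-mod17 13 = true
nonzero-square-mod17 15 = true
nonzero-square-mod17 16 = true
nonzero-square-mod17 _ = false

paley-adj : Fin 17 → Fin 17 → Bool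
paley-adj i j = nonzero-square-mod17 ((toℕ i + 17 ∸ toℕ j) % 17)

opaque
  unfolding allᶠ
  paley-adj-symmetricᵇ : T (allᶠ λ u → allᶠ λ v → ⌊ paley-adj u v Bool.≟ paley-adj v u ⌋)
  paley-adj-symmetricᵇ = _

  paley-adj-irreflexiveᵇ : T (allᶠ λ v → ⌊ paley-adj v v Bool.≟ false ⌋)
  paley-adj-irreflexiveᵇ = _

paley : Graph
paley = record
  { n = 17
  ; adj = paley-adj
  ; sym = λ u v → toWitness (allᶠ-sound (allᶠ-sound paley-adj-symmetricᵇ u) v)
  ; irrefl = λ v → toWitness (allᶠ-sound paley-adj-irreflexiveᵇ v)
  }

opaque
  moveᵇ : Fin 17 → Fin 17 → Bool
  moveᵇ u v = ⌊ Move? paley u v ⌋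

  moveᵇ-sound : ∀ {u v} → T (moveᵇ u v) → Move paley u v
  moveᵇ-sound = toWitness

  not-moveᵇ-sound : ∀ {u v} → T (not (moveᵇ u v)) → ¬ Move paley u v
  not-moveᵇ-sound = toWitnessFalse

avoidsᵇ : Fin 17 → Fin 17 → Fin 17 → Bool
avoidsᵇ x y r = not (moveᵇ x r) ∧ not (moveᵇ y r)

avoids : ∀ {x y r} → T (avoidsᵇ x y r) → ¬ Move paley x r × ¬ Move paley y r
avoids ok with Equivalence.to Bool.T-∧ ok
... | x≁r , y≁r = not-moveᵇ-sound x≁r , not-moveᵇ-sound y≁r

opaque
  unfolding allᶠ anyᶠ moveᵇ
  paley-startᵇ : T (allᶠ λ x → allᶠ λ y → anyᶠ (avoidsᵇ x y))
  paley-startᵇ = _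

  paley-escapeᵇ : T (allᶠ λ x → allᶠ λ y → allᶠ λ r →
                     ⌊ x ≟ r ⌋ ∨ ⌊ y ≟ r ⌋ ∨ anyᶠ λ r′ → moveᵇ r r′ ∧ avoidsᵇ x y r′)
  paley-escapeᵇ = _

  paley-diameter-twoᵇ : T (allᶠ λ u → allᶠ λ v → anyᶠ λ w → moveᵇ u w ∧ moveᵇ w v)
  paley-diameter-twoᵇ = _

  paley-some-pair-movesᵇ : T (allᶠ λ a → allᶠ λ b → allᶠ λ c → allᶠ λ d →
                              moveᵇ a b ∨ moveᵇ a c ∨ moveᵇ a d ∨ moveᵇ b c ∨ moveᵇ b d ∨ moveᵇ c d)
  paley-some-pair-movesᵇ = _

paley-start : ∀ x y → ∃ λ r → ¬ Move paley x r × ¬ Move paley y r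
paley-start x y = map₂ avoids (anyᶠ-sound (allᶠ-sound (allᶠ-sound paley-startᵇ x) y))

paley-escape : ∀ x y r → x ≢ r → y ≢ r → ∃ λ r′ → Move paley r r′ × ¬ Move paley x r′ × ¬ Move paley y r′
paley-escape x y r x≢r y≢r with Equivalence.to (Bool.T-∨ {⌊ x ≟ r ⌋}) (allᶠ-sound (allᶠ-sound (allᶠ-sound paley-escapeᵇ x) y) r)
... | inj₁ x≡r = contradiction (toWitness {a? = x ≟ r} x≡r) x≢r
... | inj₂ rest with Equivalence.to (Bool.T-∨ {⌊ y ≟ r ⌋}) rest
...   | inj₁ y≡r = contradiction (toWitness {a? = y ≟ r} y≡r) y≢r
...   | inj₂ escapes with anyᶠ-sound escapes
...     | r′ , ok with Equivalence.to Bool.T-∧ ok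
...       | r→r′ , r′-avoids = r′ , moveᵇ-sound r→r′ , avoids r′-avoids

paley-connected : Connected paley
paley-connected = s≤s z≤n , λ u v → walk (anyᶠ-sound (allᶠ-sound (allᶠ-sound paley-diameter-twoᵇ u) v))
  where
  walk : ∀ {u v} → ∃ (λ w → T (moveᵇ u w ∧ moveᵇ w v)) → Star (Edge paley) u v
  walk (w , ok) with Equivalence.to Bool.T-∧ ok
  ... | u→w , w→v = move⇒walk paley (moveᵇ-sound u→w) ◅◅ move⇒walk paley (moveᵇ-sound w→v)

paley-some-pair-moves : ∀ a b c d → T (moveᵇ a b ∨ moveᵇ a c ∨ moveᵇ a d ∨ moveᵇ b c ∨ moveᵇ b d ∨ moveᵇ c d)
paley-some-pair-moves a b c d = allᶠ-sound (allᶠ-sound (allᶠ-sound (allᶠ-sound paley-some-pair-movesᵇ a) b) c) d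

paley-4K1-free : FourK1Free paley
paley-4K1-free copy@(f , _) =
  neither (apart 0F 1F (λ ())) (neither (apart 0F 2F (λ ())) (neither (apart 0F 3F (λ ()))
    (neither (apart 1F 2F (λ ())) (neither (apart 1F 3F (λ ())) (apart 2F 3F (λ ()))))))
    (paley-some-pair-moves (f 0F) (f 1F) (f 2F) (f 3F))
  where
  neither : ∀ {x y} → ¬ T x → ¬ T y → ¬ T (x ∨ y)
  neither ¬x ¬y = [ ¬x , ¬y ] ∘ Equivalence.to Bool.T-∨
  apart : ∀ u v → u ≢ v → ¬ T (moveᵇ (f u) (f v))
  apart u v u≢v = edgeless-copy⇒independent paley copy u v u≢v ∘ moveᵇ-sound

two-cops-lose-on-paley : ¬ CopsWin 2 paley
two-cops-lose-on-paley = robber-evades paley start escape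
  where
  start : ∀ c → ∃ (Safe paley c)
  start c with paley-start (c 0F) (c 1F)
  ... | r , x≁r , y≁r = r , λ { 0F → x≁r ; 1F → y≁r ; (suc (suc ())) }
  escape : ∀ c r → (∀ i → c i ≢ r) → ∃ λ r′ → Move paley r r′ × Safe paley c r′
  escape c r missed with paley-escape (c 0F) (c 1F) r (missed 0F) (missed 1F)
  ... | r′ , m , x≁r′ , y≁r′ = r′ , m , λ { 0F → x≁r′ ; 1F → y≁r′ ; (suc (suc ())) }

paley-cop-number : CopNumber paley 3
paley-cop-number = three-cops-win paley (s≤s z≤n) paley-4K1-free , fewer-lose
  where
  fewer-lose : ∀ j → j < 3 → ¬ CopsWin j paley
  fewer-lose 0 _ = no-cops-lose paley (s≤s z≤n)
  fewer-lose 1 _ = two-cops-lose-on-paley ∘ copsWin-∘ paley (λ _ → 0F) λ { 0F → 0F , refl ; (suc ()) }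
  fewer-lose 2 _ = two-cops-lose-on-paley
  fewer-lose (suc (suc (suc _))) (s≤s (s≤s (s≤s ())))

corollary1p1 : ((G : Graph) → Connected G → FourK1Free G → ∃ λ k → CopNumber G k × k ≤ 3)
    × (Σ Graph λ G → Connected G × FourK1Free G × CopNumber G 3)
corollary1p1 = at-most-three-cops , (paley , paley-connected , paley-4K1-free , paley-cop-number)
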